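{- Let $H$ be a graph, $e$ an edge of $H$, $G$ a two-terminal graph, and $p\in\mathbb{C}$ with $R(G;p)\neq0$. Then $$\frac{1-p}{R(G;p)}R(H(G)_e;p)=R(H;p)+\big(y_G(p)-(p+1)\big)R(H\setminus e;p).$$
   Context: Graphs are finite and may have parallel edges and loops. For $G=(V,E)$, $R(G;p)=\sum_{A\subseteq E,\ (V,A)\text{ connected}}(1-p)^{|A|}p^{|E|-|A|}$. A two-terminal graph is $(G,s,t)$ with $s\neq t$. An $s$-$t$ split is a spanning subgraph in which every vertex has a path to exactly one of $s,t$; $S(G;p)=\sum_{A\subseteq E,\ (V,A)\ s\text{ - }t\text{ split}}(1-p)^{|A|}p^{|E|-|A|}$, and $y_G(p)=(1-p)S(G;p)/R(G;p)+1$. $H\setminus e$ is $H$ with $e$ deleted. $H(G)_e$ is obtained from $H$ by removing $e$, adding a disjoint copy of $G$, and identifying $s$ and $t$ with the two endpoints of $e$ (in either order). -}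

module Defs where

open import Level using (Level)
open import Data.Nat using (ℕ; zero; suc; _∸_)
import Data.Nat as ℕ
open import Data.Bool using (Bool; true; false; _∧_; _∨_; not; if_then_else_)
open import Data.Fin using (Fin; _↑ˡ_; _↑ʳ_; punchOut)
open import Data.Fin.Properties using (_≟_; punchOut-injective)
open import Data.Product using (_×_; _,_; proj₁; proj₂)
open import Data.List using (List; []; _∷_; length; map; foldr; _++_; lookup; removeAt; concatMap)
open import Relation.Nullary using (yes; no; ¬_)
open import Relation.Nullary.Decidable using (⌊_⌋)
open import Relation.Binary.PropositionalEquality using (_≡_; _≢_; sym)
open import Algebra.Bundles using (CommutativeRing)
import Algebra.Properties.Semiring.Exp as Exp

-- Vertices are Fin nV; the edge multiset is a list of (endpoint, endpoint)
-- pairs (an edge {a,b} is stored as (a , b) or (b , a); orientation is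
-- irrelevant for every notion below).

record Graph : Set where
  constructor graph
  field
    nV    : ℕ
    edges : List (Fin nV × Fin nV)
open Graph public

Edge : ℕ → Set
Edge n = Fin n × Fin n

-- all sub(multi)sets of an edge list (as sublists, one per subset of positions)
subsets : {X : Set} → List X → List (List X)
subsets []       = [] ∷ []
subsets (x ∷ xs) = map (x ∷_) (subsets xs) ++ subsets xs

step : {n : ℕ} → List (Edge n) → (Fin n → Bool) → (Fin n → Bool)
step A S v = S v ∨ foldr (λ ab r → ((S (proj₁ ab) ∧ ⌊ proj₂ ab ≟ v ⌋)
                                   ∨ (S (proj₂ ab) ∧ ⌊ proj₁ ab ≟ v ⌋)) ∨ r) false A

iter : {X : Set} → ℕ → (X → X) → X → X
iter zero    f x = x
iter (suc m) f x = f (iter m f x)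

-- reach A x y = true  iff  y has a path to x in (Fin n , A)
-- (n closure steps suffice, since a shortest path has < n edges)
reach : {n : ℕ} → List (Edge n) → Fin n → Fin n → Bool
reach {n} A x = iter n (step A) (λ y → ⌊ x ≟ y ⌋)

allFinB : (n : ℕ) → (Fin n → Bool) → Bool
allFinB zero    P = true
allFinB (suc n) P = P Fin.zero ∧ allFinB n (λ i → P (Fin.suc i))

-- (Fin n , A) is connected (the empty graph counts as connected)
connected : {n : ℕ} → List (Edge n) → Bool
connected {zero}  A = true
connected {suc n} A = allFinB (suc n) (reach A Fin.zero)

xor : Bool → Bool → Bool
xor a b = (a ∧ not b) ∨ (not a ∧ b)

isSplit : {n : ℕ} → List (Edge n) → Fin n → Fin n → Bool
isSplit {n} A s t = allFinB n (λ v → xor (reach A s v) (reach A t v))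

record TwoTerminal : Set where
  field
    k     : ℕ
    tedges : List (Edge (suc (suc k)))
    s t   : Fin (suc (suc k))
    s≢t   : s ≢ t
open TwoTerminal public

underlying : TwoTerminal → Graph
underlying G = graph (suc (suc (k G))) (tedges G)

deleteEdge : (H : Graph) → Fin (length (edges H)) → Graph
deleteEdge H e = graph (nV H) (removeAt (edges H) e)

-- H(G)_e : delete e = {u , v}, add a disjoint copy of G and identify
-- s with u and t with v.  Vertices: Fin (nV H + k G); the H-vertices are
-- x ↑ˡ k, the non-terminal vertices of G are the last k vertices.
module _ (H : Graph) (G : TwoTerminal) (u v : Fin (nV H)) where
  private
    K = k G
  glueV : Fin (suc (suc K)) → Fin (nV H ℕ.+ K)
  glueV w with w ≟ s G
  ... | yes _ = u ↑ˡ K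
  ... | no w≢s with w ≟ t G
  ...   | yes _ = v ↑ˡ K
  ...   | no w≢t = nV H ↑ʳ punchOut {i = punchOut (s≢t G)} {j = punchOut (λ eq → w≢s (sym eq))}
                                 (λ eq → w≢t (sym (punchOut-injective (s≢t G) (λ eq′ → w≢s (sym eq′)) eq)))

  glueE : Edge (suc (suc K)) → Edge (nV H ℕ.+ K)
  glueE (a , b) = glueV a , glueV b

  glueH : Edge (nV H) → Edge (nV H ℕ.+ K)
  glueH (a , b) = (a ↑ˡ K) , (b ↑ˡ K)

-- flip = false : s ↦ first endpoint of e, t ↦ second;  flip = true : the other order
substitute : (H : Graph) → Fin (length (edges H)) → TwoTerminal → Bool → Graph
substitute H e G flip =
  graph (nV H ℕ.+ k G)
        (map (glueH H G u v) (removeAt (edges H) e) ++ map (glueE H G u v) (tedges G))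
  where
    ab = lookup (edges H) e
    u = if flip then proj₂ ab else proj₁ ab
    v = if flip then proj₁ ab else proj₂ ab

module Poly {c ℓ : Level} (ℛ : CommutativeRing c ℓ) where
  open CommutativeRing ℛ
  open Exp semiring using (_^_)

  weightedSum : {n : ℕ} → (List (Edge n) → Bool) → Carrier → List (Edge n) → Carrier
  weightedSum P p E =
    foldr _+_ 0# (map (λ A → if P A then ((1# - p) ^ length A) * (p ^ (length E ∸ length A)) else 0#)
                      (subsets E))

  Rel : Graph → Carrier → Carrier
  Rel H p = weightedSum connected p (edges H)

  Spl : TwoTerminal → Carrier → Carrier
  Spl G p = weightedSum (λ A → isSplit A (s G) (t G)) p (tedges G)

module Submission where

-- Write every polynomial as the expectation 𝔼 of an indicator over a random edge subset in
-- which each edge survives with probability 1 - p, and condition on the surviving edges a of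
-- H \ e and b of G.  The graph glued from a and b is connected exactly when b is connected and
-- a + e is connected, or b is an s-t split and a is connected: in every other case some vertex
-- of G reaches neither terminal and is cut off from H.  Averaging over b gives
--   R(H(G)_e) = R(G) R⁺ + S(G) R(H \ e),   R⁺ = R(H | e survives),
-- while conditioning on e gives R(H) = (1 - p) R⁺ + p R(H \ e); eliminating R⁺ using
-- r R(G) = 1 is the claimed identity.

open import Defs
open import Level using (Level)
open import Data.Nat using (ℕ; zero; suc; _∸_; _<_; z≤n)
import Data.Nat as ℕ
open import Data.Nat.Properties using (≤-<-trans; ≤⇒≯)
import Data.Nat.Properties as ℕₚ
open import Data.Bool using (Bool; true; false; T; _∧_; _∨_; if_then_else_)
open import Data.Bool.Properties using (T-∧; T-∨; T-≡)
open import Data.Fin using (Fin; _↑ˡ_; _↑ʳ_; splitAt; punchIn; punchOut)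
open import Data.Fin.Properties
  using (_≟_; any?; splitAt-↑ˡ; splitAt-↑ʳ; splitAt⁻¹-↑ˡ; splitAt⁻¹-↑ʳ; punchIn-punchOut; punchInᵢ≢i; punchIn-injective)
import Data.Fin.Subset as Subset
open import Data.Fin.Subset.Properties using (∣p∣≤n; p⊂q⇒∣p∣<∣q∣)
open import Data.Vec using (tabulate)
open import Data.Vec.Properties using (lookup∘tabulate; lookup⇒[]=; []=⇒lookup)
open import Data.Product using (_×_; _,_; proj₁; proj₂; ∃; ∃₂)
import Data.Sum as Sum
open import Data.Sum using (_⊎_; inj₁; inj₂; [_,_]′)
open import Data.List using (List; []; _∷_; map; foldr; _++_; length; lookup; removeAt)
open import Data.List.Properties using (map-∘)
import Data.List.Relation.Unary.Any as Any
open import Data.List.Relation.Unary.Any using (Any; here; there)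
open import Data.List.Relation.Unary.Any.Properties using (map⁺; ++⁺ˡ; ++⁺ʳ; ++⁻)
open import Data.List.Relation.Binary.Permutation.Propositional using (_↭_; ↭-refl; ↭-prep; ↭-swap; ↭-sym)
open import Data.List.Relation.Binary.Permutation.Propositional.Properties using (Any-resp-↭)
open import Data.Empty using (⊥-elim)
open import Data.Maybe using (nothing)
open import Function using (_∘_; id; const)
open import Function.Bundles using (_⇔_; mk⇔; Equivalence)
open import Function.Properties.Equivalence using () renaming (trans to ⇔-trans)
open import Function.Related.TypeIsomorphisms using (¬-cong-⇔)
open import Data.Sum.Function.Propositional using (_⊎-⇔_)
open import Data.Product.Function.NonDependent.Propositional using (_×-⇔_)
open import Relation.Nullary using (¬_; yes; no)
open import Relation.Nullary.Decidable using (⌊_⌋; toWitness; fromWitness; T?; ¬?; _×-dec_; decidable-stable)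
open import Relation.Binary.PropositionalEquality using (_≡_; _≢_; refl; sym; trans; cong; subst; subst₂)
open import Relation.Binary.Construct.Closure.ReflexiveTransitive
  using (Star; ε; _◅_; _◅◅_; return; reverse; gmap; concat; fold)
open import Algebra.Bundles using (CommutativeRing)
import Algebra.Properties.Semiring.Exp as Exp
import Algebra.Properties.Ring as RingProperties
import Algebra.Properties.AbelianGroup as AbelianGroupProperties
import Algebra.Properties.CommutativeSemigroup as CommutativeSemigroupProperties
import Tactic.RingSolver.Core.AlmostCommutativeRing as ACR
import Tactic.RingSolver.NonReflective as Solver
import Relation.Binary.Reasoning.Setoid as SetoidReasoning

open Equivalence using (to; from)

T-injective : {a b : Bool} → (T a ⇔ T b) → a ≡ b
T-injective {false} {false} _   = refl
T-injective {false} {true}  a⇔b = ⊥-elim (from a⇔b _)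
T-injective {true}  {false} a⇔b = ⊥-elim (to a⇔b _)
T-injective {true}  {true}  _   = refl

T-xor : {a b : Bool} → T (xor a b) ⇔ ((T a ⊎ T b) × ¬ (T a × T b))
T-xor {false} {false} = mk⇔ (λ ()) (λ { (inj₁ () , _) ; (inj₂ () , _) })
T-xor {false} {true}  = mk⇔ (λ _ → inj₂ _ , proj₁) (λ _ → _)
T-xor {true}  {false} = mk⇔ (λ _ → inj₁ _ , proj₂) (λ _ → _)
T-xor {true}  {true}  = mk⇔ (λ ()) (λ (_ , ¬both) → ¬both (_ , _))

-- Paths and reachability

Joins : {n : ℕ} → Fin n → Fin n → Edge n → Set
Joins a b e = (proj₁ e ≡ a × proj₂ e ≡ b) ⊎ (proj₁ e ≡ b × proj₂ e ≡ a)

Adj : {n : ℕ} → List (Edge n) → Fin n → Fin n → Set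
Adj A a b = Any (Joins a b) A

Path : {n : ℕ} → List (Edge n) → Fin n → Fin n → Set
Path A = Star (Adj A)

module _ {n : ℕ} where

  adj-sym : {A : List (Edge n)} {a b : Fin n} → Adj A a b → Adj A b a
  adj-sym (here (inj₁ (p , q))) = here (inj₂ (p , q))
  adj-sym (here (inj₂ (p , q))) = here (inj₁ (p , q))
  adj-sym (there r)             = there (adj-sym r)

  path-sym : {A : List (Edge n)} {a b : Fin n} → Path A a b → Path A b a
  path-sym = reverse adj-sym

  path-invariant : {A : List (Edge n)} {X : Set} (f : Fin n → X) → (∀ {a b} → Adj A a b → f a ≡ f b) →
                   ∀ {x y} → Path A x y → f x ≡ f y
  path-invariant f f-adj = fold (λ x y → f x ≡ f y) (λ r eq → trans (f-adj r) eq) refl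

path-map : {n₁ n₂ : ℕ} {A : List (Edge n₁)} {C : List (Edge n₂)} (φ : Fin n₁ → Fin n₂) →
           (∀ {a b} → Adj A a b → Path C (φ a) (φ b)) → ∀ {x y} → Path A x y → Path C (φ x) (φ y)
path-map φ φ-adj = concat ∘ gmap φ φ-adj

path-mono : {n : ℕ} {A A′ : List (Edge n)} → (∀ {a b} → Adj A a b → Adj A′ a b) →
            ∀ {x y} → Path A x y → Path A′ x y
path-mono = gmap id

module _ {n : ℕ} where

  infix 4 _⊆_
  _⊆_ : (Fin n → Bool) → (Fin n → Bool) → Set
  S ⊆ S′ = ∀ {v} → T (S v) → T (S′ v)

  ∣_∣ : (Fin n → Bool) → ℕ
  ∣ S ∣ = Subset.∣ tabulate S ∣

  ∈-tabulate : (S : Fin n → Bool) {v : Fin n} → v Subset.∈ tabulate S ⇔ T (S v)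
  ∈-tabulate S {v} = mk⇔
    (λ v∈S → from T-≡ (trans (sym (lookup∘tabulate S v)) ([]=⇒lookup v∈S)))
    (λ Sv → lookup⇒[]= v (tabulate S) (trans (lookup∘tabulate S v) (to T-≡ Sv)))

  ⊆-or-witness : (S S′ : Fin n → Bool) → S ⊆ S′ ⊎ ∃ λ v → T (S v) × ¬ T (S′ v)
  ⊆-or-witness S S′ with any? (λ v → T? (S v) ×-dec ¬? (T? (S′ v)))
  ... | yes witness = inj₂ witness
  ... | no ¬witness = inj₁ λ {v} Sv → decidable-stable (T? (S′ v)) (λ ¬S′v → ¬witness (v , Sv , ¬S′v))

  ⊂⇒∣∣< : (S S′ : Fin n → Bool) → S ⊆ S′ → ∀ {v} → T (S′ v) → ¬ T (S v) → ∣ S ∣ < ∣ S′ ∣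
  ⊂⇒∣∣< S S′ S⊆S′ {v} S′v ¬Sv = p⊂q⇒∣p∣<∣q∣
    ( (λ x∈S → from (∈-tabulate S′) (S⊆S′ (to (∈-tabulate S) x∈S)))
    , v , from (∈-tabulate S′) S′v , ¬Sv ∘ to (∈-tabulate S))

  hits : (Fin n → Bool) → Fin n → Edge n → Bool
  hits S v (a , b) = (S a ∧ ⌊ b ≟ v ⌋) ∨ (S b ∧ ⌊ a ≟ v ⌋)

  -- the second disjunct in the definition of `step`
  frontier : List (Edge n) → (Fin n → Bool) → Fin n → Bool
  frontier A S v = foldr (λ ab r → hits S v ab ∨ r) false A

  frontier⇒adj : (A : List (Edge n)) {S : Fin n → Bool} {v : Fin n} →
                 T (frontier A S v) → ∃ λ w → T (S w) × Adj A w v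
  frontier⇒adj ((a , b) ∷ A) {S} {v} h with to (T-∨ {hits S v (a , b)}) h
  ... | inj₂ h′ with w , Sw , r ← frontier⇒adj A h′ = w , Sw , there r
  ... | inj₁ h′ with to (T-∨ {S a ∧ ⌊ b ≟ v ⌋}) h′
  ...   | inj₁ h″ = a , proj₁ (to T-∧ h″) , here (inj₁ (refl , toWitness (proj₂ (to (T-∧ {S a}) h″))))
  ...   | inj₂ h″ = b , proj₁ (to T-∧ h″) , here (inj₂ (toWitness (proj₂ (to (T-∧ {S b}) h″)) , refl))

  adj⇒frontier : (A : List (Edge n)) {S : Fin n → Bool} {w v : Fin n} →
                 T (S w) → Adj A w v → T (frontier A S v)
  adj⇒frontier ((a , b) ∷ _) {S} Sw (here (inj₁ (refl , refl))) =
    from T-∨ (inj₁ (from (T-∨ {S a ∧ ⌊ b ≟ b ⌋}) (inj₁ (from (T-∧ {S a}) (Sw , fromWitness refl)))))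
  adj⇒frontier ((a , b) ∷ _) {S} Sw (here (inj₂ (refl , refl))) =
    from T-∨ (inj₁ (from (T-∨ {S a ∧ ⌊ b ≟ a ⌋}) (inj₂ (from (T-∧ {S b}) (Sw , fromWitness refl)))))
  adj⇒frontier (ab ∷ A) {S} {v = v} Sw (there r) = from (T-∨ {hits S v ab}) (inj₂ (adj⇒frontier A {S} Sw r))

  step-inflationary : (A : List (Edge n)) (S : Fin n → Bool) → S ⊆ step A S
  step-inflationary A S Sv = from T-∨ (inj₁ Sv)

  step-adj : (A : List (Edge n)) {S : Fin n → Bool} {w v : Fin n} → T (S w) → Adj A w v → T (step A S v)
  step-adj A {S} Sw r = from T-∨ (inj₂ (adj⇒frontier A {S} Sw r))

  step-⇒ : (A : List (Edge n)) {S : Fin n → Bool} {v : Fin n} →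
           T (step A S v) → T (S v) ⊎ ∃ λ w → T (S w) × Adj A w v
  step-⇒ A {S} {v} h with to (T-∨ {S v}) h
  ... | inj₁ Sv = inj₁ Sv
  ... | inj₂ h′ = inj₂ (frontier⇒adj A h′)

  step-mono : (A : List (Edge n)) {S S′ : Fin n → Bool} → S ⊆ S′ → step A S ⊆ step A S′
  step-mono A {S′ = S′} S⊆S′ h with step-⇒ A h
  ... | inj₁ Sv           = step-inflationary A S′ (S⊆S′ Sv)
  ... | inj₂ (w , Sw , r) = step-adj A {S′} (S⊆S′ Sw) r

module Reachability {n : ℕ} (A : List (Edge n)) (x : Fin n) where

  reached : ℕ → Fin n → Bool
  reached m = iter m (step A) (λ y → ⌊ x ≟ y ⌋)

  reached-sound : ∀ m {v} → T (reached m v) → Path A x v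
  reached-sound zero    h = subst (Path A x) (toWitness h) ε
  reached-sound (suc m) h with step-⇒ A h
  ... | inj₁ h′           = reached-sound m h′
  ... | inj₂ (w , Sw , r) = reached-sound m Sw ◅◅ return r

  reached-start : ∀ m → T (reached m x)
  reached-start zero    = fromWitness refl
  reached-start (suc m) = step-inflationary A (reached m) (reached-start m)

  Closed : (Fin n → Bool) → Set
  Closed S = step A S ⊆ S

  closed-or-large : ∀ m → Closed (reached m) ⊎ m < ∣ reached m ∣
  closed-or-large zero =
    inj₂ (≤-<-trans z≤n (⊂⇒∣∣< (λ _ → false) (reached zero) (λ ()) (reached-start zero) (λ ())))
  closed-or-large (suc m) with ⊆-or-witness (reached (suc m)) (reached m)
  ... | inj₁ shrinks = inj₁ (step-mono A shrinks)
  ... | inj₂ (v , new , ¬old) with closed-or-large m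
  ...   | inj₁ closed = ⊥-elim (¬old (closed new))
  ...   | inj₂ large  =
    inj₂ (≤-<-trans large (⊂⇒∣∣< (reached m) (reached (suc m)) (step-inflationary A (reached m)) new ¬old))

  reached-closed : Closed (reached n)
  reached-closed with closed-or-large n
  ... | inj₁ closed = closed
  ... | inj₂ large  = ⊥-elim (≤⇒≯ (∣p∣≤n (tabulate (reached n))) large)

  closed-path : {S : Fin n → Bool} → Closed S → ∀ {w v} → T (S w) → Path A w v → T (S v)
  closed-path closed Sw ε        = Sw
  closed-path closed Sw (r ◅ rs) = closed-path closed (closed (step-adj A Sw r)) rs

reach-correct : {n : ℕ} {A : List (Edge n)} {x v : Fin n} → T (reach A x v) ⇔ Path A x v
reach-correct {n} {A} {x} = mk⇔ (reached-sound n) (closed-path reached-closed (reached-start n))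
  where open Reachability A x

reach-adj : {n : ℕ} {A : List (Edge n)} {x w v : Fin n} → Adj A w v → T (reach A x w) → T (reach A x v)
reach-adj r x↝w = from reach-correct (to reach-correct x↝w ◅◅ return r)

-- Connectedness and s-t splits

allFinB-correct : (n : ℕ) (P : Fin n → Bool) → T (allFinB n P) ⇔ (∀ i → T (P i))
allFinB-correct zero    _ = mk⇔ (λ _ ()) (λ _ → _)
allFinB-correct (suc n) P = mk⇔
  (λ h → λ { Fin.zero → proj₁ (to T-∧ h) ; (Fin.suc i) → to (allFinB-correct n (P ∘ Fin.suc)) (proj₂ (to (T-∧ {P Fin.zero}) h)) i })
  (λ h → from T-∧ (h Fin.zero , from (allFinB-correct n (P ∘ Fin.suc)) (h ∘ Fin.suc)))

connected⇔ : {n : ℕ} {A : List (Edge (suc n))} → T (connected A) ⇔ (∀ x y → Path A x y)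
connected⇔ {n} {A} = mk⇔
  (λ h x y → path-sym (from-zero h x) ◅◅ from-zero h y)
  (λ h → from (allFinB-correct (suc n) (reach A Fin.zero)) (λ w → from reach-correct (h Fin.zero w)))
  where
  from-zero : T (connected A) → ∀ w → Path A Fin.zero w
  from-zero h w = to reach-correct (to (allFinB-correct (suc n) (reach A Fin.zero)) h w)

connected-from : {n : ℕ} {A : List (Edge (suc n))} (r : Fin (suc n)) → (∀ w → Path A r w) → T (connected A)
connected-from r h = from connected⇔ (λ x y → path-sym (h x) ◅◅ h y)

Split : {n : ℕ} → List (Edge n) → Fin n → Fin n → Set
Split A a b = ∀ w → (Path A a w ⊎ Path A b w) × ¬ (Path A a w × Path A b w)

isSplit⇔ : {n : ℕ} {A : List (Edge n)} {a b : Fin n} → T (isSplit A a b) ⇔ Split A a b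
isSplit⇔ {n} {A} {a} {b} = mk⇔
  (λ h w → to (exactly-one w) (to allFin⇔ h w))
  (λ h → from allFin⇔ (λ w → from (exactly-one w) (h w)))
  where
  allFin⇔ = allFinB-correct n (λ w → xor (reach A a w) (reach A b w))
  exactly-one : ∀ w → T (xor (reach A a w) (reach A b w)) ⇔ ((Path A a w ⊎ Path A b w) × ¬ (Path A a w × Path A b w))
  exactly-one w = ⇔-trans T-xor ((reach-correct ⊎-⇔ reach-correct) ×-⇔ ¬-cong-⇔ (reach-correct ×-⇔ reach-correct))

connected-cong : {n : ℕ} {A A′ : List (Edge n)} → (∀ {a b} → Adj A a b ⇔ Adj A′ a b) → connected A ≡ connected A′
connected-cong {zero}  _      = refl
connected-cong {suc n} A⇔A′ = T-injective (mk⇔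
  (λ h → from connected⇔ (λ x y → path-mono (to A⇔A′) (to connected⇔ h x y)))
  (λ h → from connected⇔ (λ x y → path-mono (from A⇔A′) (to connected⇔ h x y))))

connected⇒¬isSplit : {n : ℕ} {A : List (Edge (suc n))} {a b : Fin (suc n)} →
                     T (connected A) → ¬ T (isSplit A a b)
connected⇒¬isSplit {A = A} {a} {b} conn split =
  proj₂ (to (isSplit⇔ {A = A}) split b) (to connected⇔ conn a b , ε)

connected-or-isSplit : {n : ℕ} {A : List (Edge (suc n))} {a b : Fin (suc n)} →
                       (∀ w → Path A a w ⊎ Path A b w) → T (connected A) ⊎ T (isSplit A a b)
connected-or-isSplit {A = A} {a} {b} a∨b↝ with T? (reach A a b)
... | yes a↝b = inj₁ (connected-from a λ w → [ id , to reach-correct a↝b ◅◅_ ]′ (a∨b↝ w))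
... | no ¬a↝b = inj₂ (from isSplit⇔ λ w →
  a∨b↝ w , λ (a↝w , b↝w) → ¬a↝b (from reach-correct (a↝w ◅◅ path-sym b↝w)))

connected-resp-↭ : {n : ℕ} {A A′ : List (Edge n)} → A ↭ A′ → connected A ≡ connected A′
connected-resp-↭ A↭A′ = connected-cong (mk⇔ (Any-resp-↭ A↭A′) (Any-resp-↭ (↭-sym A↭A′)))

connected-∷-swap : {n : ℕ} (x y : Fin n) (A : List (Edge n)) → connected ((x , y) ∷ A) ≡ connected ((y , x) ∷ A)
connected-∷-swap x y A = connected-cong (mk⇔ reverse-head reverse-head)
  where
  reverse-head : ∀ {x y a b} → Adj ((x , y) ∷ A) a b → Adj ((y , x) ∷ A) a b
  reverse-head (here (inj₁ (p , q))) = here (inj₂ (q , p))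
  reverse-head (here (inj₂ (p , q))) = here (inj₁ (q , p))
  reverse-head (there r)             = there r

connected-orient : {n : ℕ} (flip : Bool) (ab : Edge n) (A : List (Edge n)) →
  connected (((if flip then proj₂ ab else proj₁ ab) , (if flip then proj₁ ab else proj₂ ab)) ∷ A) ≡ connected (ab ∷ A)
connected-orient false ab A = refl
connected-orient true  ab A = connected-∷-swap (proj₂ ab) (proj₁ ab) A

-- Gluing G into H in place of an edge

mapEdge : {n₁ n₂ : ℕ} → (Fin n₁ → Fin n₂) → Edge n₁ → Edge n₂
mapEdge φ (a , b) = φ a , φ b

module _ {n₁ n₂ : ℕ} (φ : Fin n₁ → Fin n₂) where

  adj-map⁺ : {A : List (Edge n₁)} {a b : Fin n₁} → Adj A a b → Adj (map (mapEdge φ) A) (φ a) (φ b)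
  adj-map⁺ = map⁺ ∘ Any.map λ { (inj₁ (p , q)) → inj₁ (cong φ p , cong φ q)
                              ; (inj₂ (p , q)) → inj₂ (cong φ p , cong φ q) }

  adj-map⁻ : {A : List (Edge n₁)} {x y : Fin n₂} → Adj (map (mapEdge φ) A) x y →
             ∃₂ λ a b → Adj A a b × φ a ≡ x × φ b ≡ y
  adj-map⁻ {e ∷ _} (here (inj₁ (p , q))) = proj₁ e , proj₂ e , here (inj₁ (refl , refl)) , p , q
  adj-map⁻ {e ∷ _} (here (inj₂ (p , q))) = proj₂ e , proj₁ e , here (inj₂ (refl , refl)) , q , p
  adj-map⁻ {_ ∷ _} (there r) with a , b , r′ , p , q ← adj-map⁻ r = a , b , there r′ , p , q

module Glue {n′ : ℕ} (E : List (Edge (suc n′))) (G : TwoTerminal) (u v : Fin (suc n′)) where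

  private
    N = suc n′
    K = k G
    H = graph N E

  ιH : Fin N → Fin (N ℕ.+ K)
  ιH x = x ↑ˡ K

  ιG : Fin (suc (suc K)) → Fin (N ℕ.+ K)
  ιG = glueV H G u v

  ιG-s : ιG (s G) ≡ ιH u
  ιG-s with s G ≟ s G
  ... | yes _  = refl
  ... | no s≢s = ⊥-elim (s≢s refl)

  ιG-t : ιG (t G) ≡ ιH v
  ιG-t with t G ≟ s G
  ... | yes t≡s = ⊥-elim (s≢t G (sym t≡s))
  ... | no _ with t G ≟ t G
  ...   | yes _  = refl
  ...   | no t≢t = ⊥-elim (t≢t refl)

  -- the non-terminal vertices of G, in the order in which glueV numbers them
  inner : Fin K → Fin (suc (suc K))
  inner j = punchIn (s G) (punchIn (punchOut (s≢t G)) j)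

  inner-punchOut : ∀ {g} (g≢s : s G ≢ g) g≢t → inner (punchOut {i = punchOut (s≢t G)} {j = punchOut g≢s} g≢t) ≡ g
  inner-punchOut g≢s g≢t = trans (cong (punchIn (s G)) (punchIn-punchOut g≢t)) (punchIn-punchOut g≢s)

  inner-injective : ∀ i j → inner i ≡ inner j → i ≡ j
  inner-injective i j = punchIn-injective _ i j ∘ punchIn-injective (s G) _ _

  ιG-nonterminal : ∀ g → g ≢ s G → g ≢ t G → ∃ λ j → ιG g ≡ N ↑ʳ j × inner j ≡ g
  ιG-nonterminal g g≢s g≢t with g ≟ s G
  ... | yes g≡s = ⊥-elim (g≢s g≡s)
  ... | no _ with g ≟ t G
  ...   | yes g≡t = ⊥-elim (g≢t g≡t)
  ...   | no _    = _ , refl , inner-punchOut _ _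

  ιG-inner : ∀ j → ιG (inner j) ≡ N ↑ʳ j
  ιG-inner j with ιG-nonterminal (inner j) (punchInᵢ≢i (s G) _) inner≢t
    where
    inner≢t : inner j ≢ t G
    inner≢t eq = punchInᵢ≢i _ j (punchIn-injective (s G) _ _ (trans eq (sym (punchIn-punchOut (s≢t G)))))
  ... | j′ , ιG≡ , inner≡ = trans ιG≡ (cong (N ↑ʳ_) (inner-injective j′ j inner≡))

  vertex-cases : ∀ w → (∃ λ x → ιH x ≡ w) ⊎ (∃ λ g → ιG g ≡ w)
  vertex-cases w with splitAt N w in eq
  ... | inj₁ x = inj₁ (x , splitAt⁻¹-↑ˡ eq)
  ... | inj₂ j = inj₂ (inner j , trans (ιG-inner j) (splitAt⁻¹-↑ʳ eq))

  extend : {X : Set} → (Fin N → X) → (Fin (suc (suc K)) → X) → Fin (N ℕ.+ K) → X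
  extend f h w = [ f , h ∘ inner ]′ (splitAt N w)

  extend-ιH : {X : Set} (f : Fin N → X) (h : Fin (suc (suc K)) → X) (x : Fin N) → extend f h (ιH x) ≡ f x
  extend-ιH f h x rewrite splitAt-↑ˡ N x K = refl

  extend-ιG : {X : Set} (f : Fin N → X) (h : Fin (suc (suc K)) → X) →
              h (s G) ≡ f u → h (t G) ≡ f v → ∀ g → extend f h (ιG g) ≡ h g
  extend-ιG f h hs ht g with g ≟ s G
  ... | yes refl = trans (extend-ιH f h u) (sym hs)
  ... | no _ with g ≟ t G
  ...   | yes refl = trans (extend-ιH f h v) (sym ht)
  ...   | no _     = trans (cong [ f , h ∘ inner ]′ (splitAt-↑ʳ N K _)) (cong h (inner-punchOut _ _))

  module _ (a : List (Edge N)) (b : List (Edge (suc (suc K)))) where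

    glued : List (Edge (N ℕ.+ K))
    glued = map (glueH H G u v) a ++ map (glueE H G u v) b

    adj-glued-H : ∀ {x y} → Adj a x y → Adj glued (ιH x) (ιH y)
    adj-glued-H = ++⁺ˡ ∘ adj-map⁺ ιH

    adj-glued-G : ∀ {g h} → Adj b g h → Adj glued (ιG g) (ιG h)
    adj-glued-G = ++⁺ʳ (map (glueH H G u v) a) ∘ adj-map⁺ ιG

    adj-glued⁻ : ∀ {x y} → Adj glued x y →
                 (∃₂ λ p q → Adj a p q × ιH p ≡ x × ιH q ≡ y) ⊎ (∃₂ λ g h → Adj b g h × ιG g ≡ x × ιG h ≡ y)
    adj-glued⁻ = Sum.map (adj-map⁻ ιH) (adj-map⁻ ιG) ∘ ++⁻ (map (glueH H G u v) a)

    path-glued-G : ∀ {g h} → Path b g h → Path glued (ιG g) (ιG h)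
    path-glued-G = path-map ιG (return ∘ adj-glued-G)

    path-glued-from-s : ∀ {g} → Path b (s G) g → Path glued (ιH u) (ιG g)
    path-glued-from-s {g} = subst (λ w → Path glued w (ιG g)) ιG-s ∘ path-glued-G

    path-glued-from-t : ∀ {g} → Path b (t G) g → Path glued (ιH v) (ιG g)
    path-glued-from-t {g} = subst (λ w → Path glued w (ιG g)) ιG-t ∘ path-glued-G

    -- an s-t path of b plays the role of the deleted edge uv
    adj-uv-glued : Path b (s G) (t G) → ∀ {x y} → Adj ((u , v) ∷ a) x y → Path glued (ιH x) (ιH y)
    adj-uv-glued st (here (inj₁ (refl , refl))) = subst (Path glued (ιH u)) ιG-t (path-glued-from-s st)
    adj-uv-glued st (here (inj₂ (refl , refl))) = path-sym (adj-uv-glued st (here (inj₁ (refl , refl))))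
    adj-uv-glued st (there r)                   = return (adj-glued-H r)

    connected-glued-intro : (∀ x → Path glued (ιH u) (ιH x)) → (∀ g → Path b (s G) g ⊎ Path b (t G) g) →
                            T (connected glued)
    connected-glued-intro reachH reachG = connected-from (ιH u) λ w → case (vertex-cases w)
      where
      case : ∀ {w} → (∃ λ x → ιH x ≡ w) ⊎ (∃ λ g → ιG g ≡ w) → Path glued (ιH u) w
      case (inj₁ (x , refl)) = reachH x
      case (inj₂ (g , refl)) with reachG g
      ... | inj₁ sg = path-glued-from-s sg
      ... | inj₂ tg = reachH v ◅◅ path-glued-from-t tg

    -- collapsing G onto H along c maps glued paths to paths of C
    connected-glued-elim : (c : Fin (suc (suc K)) → Fin N) → c (s G) ≡ u → c (t G) ≡ v →
                           (C : List (Edge N)) → (∀ {x y} → Adj a x y → Adj C x y) →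
                           (∀ {g h} → Adj b g h → Path C (c g) (c h)) →
                           T (connected glued) → T (connected C)
    connected-glued-elim c cs ct C a⊆C b↦C conn = from connected⇔ λ x y →
      subst₂ (Path C) (extend-ιH id c x) (extend-ιH id c y)
             (path-map ρ adj↦C (to connected⇔ conn (ιH x) (ιH y)))
      where
      ρ : Fin (N ℕ.+ K) → Fin N
      ρ = extend id c
      adj↦C : ∀ {w w′} → Adj glued w w′ → Path C (ρ w) (ρ w′)
      adj↦C r with adj-glued⁻ r
      ... | inj₁ (p , q , r′ , refl , refl) =
        subst₂ (Path C) (sym (extend-ιH id c p)) (sym (extend-ιH id c q)) (return (a⊆C r′))
      ... | inj₂ (g , h , r′ , refl , refl) =
        subst₂ (Path C) (sym (extend-ιG id c cs ct g)) (sym (extend-ιG id c cs ct h)) (b↦C r′)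

    glued-connected-if-connected : T (connected b) → connected glued ≡ connected ((u , v) ∷ a)
    glued-connected-if-connected conn-b = T-injective (mk⇔
      (connected-glued-elim c c-s c-t ((u , v) ∷ a) there (λ {g} {h} _ → path-sym (u↝c g) ◅◅ u↝c h))
      (λ conn-C → connected-glued-intro
         (λ x → path-map ιH (adj-uv-glued (s↝ (t G))) (to connected⇔ conn-C u x))
         (inj₁ ∘ s↝)))
      where
      s↝ : ∀ g → Path b (s G) g
      s↝ = to connected⇔ conn-b (s G)
      c : Fin (suc (suc K)) → Fin N
      c g with g ≟ t G
      ... | yes _ = v
      ... | no _  = u
      c-s : c (s G) ≡ u
      c-s with s G ≟ t G
      ... | yes s≡t = ⊥-elim (s≢t G s≡t)
      ... | no _    = refl
      c-t : c (t G) ≡ v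
      c-t with t G ≟ t G
      ... | yes _  = refl
      ... | no t≢t = ⊥-elim (t≢t refl)
      u↝c : ∀ g → Path ((u , v) ∷ a) u (c g)
      u↝c g with g ≟ t G
      ... | yes _ = return (here (inj₁ (refl , refl)))
      ... | no _  = ε

    glued-connected-if-split : T (isSplit b (s G) (t G)) → connected glued ≡ connected a
    glued-connected-if-split split-b = T-injective (mk⇔
      (connected-glued-elim c c-s c-t a id (λ r → subst (Path a (c _)) (c-adj r) ε))
      (λ conn-a → connected-glued-intro
         (λ x → path-map ιH (return ∘ adj-glued-H) (to connected⇔ conn-a u x))
         (proj₁ ∘ split)))
      where
      split : Split b (s G) (t G)
      split = to isSplit⇔ split-b
      c : Fin (suc (suc K)) → Fin N
      c g = if reach b (s G) g then u else v
      c-s : c (s G) ≡ u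
      c-s = cong (if_then u else v) (to T-≡ (from (reach-correct {A = b}) ε))
      c-t : c (t G) ≡ v
      c-t = cong (if_then u else v)
        (T-injective (mk⇔ (λ s↝t → proj₂ (split (t G)) (to reach-correct s↝t , ε)) λ ()))
      c-adj : ∀ {g h} → Adj b g h → c g ≡ c h
      c-adj r = cong (if_then u else v) (T-injective (mk⇔ (reach-adj r) (reach-adj (adj-sym r))))

    -- In a connected glued graph every G-vertex is reached from a terminal, since the
    -- indicator of "H-vertex or reached from a terminal" is constant along glued edges.
    glued-disconnected : ¬ T (connected b) → ¬ T (isSplit b (s G) (t G)) → ¬ T (connected glued)
    glued-disconnected ¬conn-b ¬split-b conn =
      [ ¬conn-b , ¬split-b ]′ (connected-or-isSplit terminal↝)
      where
      τ : Fin (suc (suc K)) → Bool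
      τ g = reach b (s G) g ∨ reach b (t G) g
      τ-s : τ (s G) ≡ true
      τ-s = to T-≡ (from T-∨ (inj₁ (from (reach-correct {A = b}) ε)))
      τ-t : τ (t G) ≡ true
      τ-t = to T-≡ (from (T-∨ {reach b (s G) (t G)}) (inj₂ (from (reach-correct {A = b}) ε)))
      τ-adj : ∀ {g h} → Adj b g h → τ g ≡ τ h
      τ-adj r = T-injective (mk⇔ (extend-path r) (extend-path (adj-sym r)))
        where
        extend-path : ∀ {g h} → Adj b g h → T (τ g) → T (τ h)
        extend-path {g} r τg = from T-∨ (Sum.map (reach-adj r) (reach-adj r) (to (T-∨ {reach b (s G) g}) τg))
      χ : Fin (N ℕ.+ K) → Bool
      χ = extend (const true) τ
      χ-adj : ∀ {w w′} → Adj glued w w′ → χ w ≡ χ w′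
      χ-adj r with adj-glued⁻ r
      ... | inj₁ (p , q , _ , refl , refl) = trans (extend-ιH _ τ p) (sym (extend-ιH _ τ q))
      ... | inj₂ (g , h , r′ , refl , refl) =
        trans (extend-ιG _ τ τ-s τ-t g) (trans (τ-adj r′) (sym (extend-ιG _ τ τ-s τ-t h)))
      terminal↝ : ∀ g → Path b (s G) g ⊎ Path b (t G) g
      terminal↝ g = Sum.map (to reach-correct) (to reach-correct) (to T-∨ (from T-≡ τg≡true))
        where
        τg≡true : τ g ≡ true
        τg≡true = trans (sym (extend-ιG _ τ τ-s τ-t g))
                        (trans (sym (path-invariant χ χ-adj (to connected⇔ conn (ιH u) (ιG g))))
                               (extend-ιH _ τ u))

-- Random edge subsets

module Expectation {c ℓ : Level} (ℛ : CommutativeRing c ℓ) where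

  open CommutativeRing ℛ renaming (refl to ≈-refl; sym to ≈-sym; trans to ≈-trans)
  open Poly ℛ
  open Exp semiring using (_^_)
  open Solver (ACR.fromCommutativeRing ℛ (λ _ → nothing))
  open SetoidReasoning setoid
  open CommutativeSemigroupProperties *-commutativeSemigroup using (x∙yz≈y∙xz; xy∙z≈y∙xz)

  𝟙 : Bool → Carrier
  𝟙 b = if b then 1# else 0#

  -- 𝔼 p E F = Σ_{A ⊆ E} (1-p)^|A| p^(|E|-|A|) F(A): the expectation of F on the random
  -- sublist of E keeping each entry independently with probability 1 - p.
  𝔼 : {X : Set} → Carrier → List X → (List X → Carrier) → Carrier
  𝔼 p []       F = F []
  𝔼 p (x ∷ xs) F = (1# - p) * 𝔼 p xs (F ∘ (x ∷_)) + p * 𝔼 p xs F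

  module _ (p : Carrier) where

    𝔼-cong : {X : Set} (E : List X) {F F′ : List X → Carrier} → (∀ A → F A ≈ F′ A) → 𝔼 p E F ≈ 𝔼 p E F′
    𝔼-cong []       F≈F′ = F≈F′ []
    𝔼-cong (x ∷ xs) F≈F′ = +-cong (*-congˡ (𝔼-cong xs (F≈F′ ∘ (x ∷_)))) (*-congˡ (𝔼-cong xs F≈F′))

    𝔼-*ˡ : {X : Set} (E : List X) (a : Carrier) (F : List X → Carrier) → 𝔼 p E (λ A → a * F A) ≈ a * 𝔼 p E F
    𝔼-*ˡ []       a F = ≈-refl
    𝔼-*ˡ (x ∷ xs) a F = begin
      (1# - p) * 𝔼 p xs (λ A → a * F (x ∷ A)) + p * 𝔼 p xs (λ A → a * F A)
        ≈⟨ +-cong (*-congˡ (𝔼-*ˡ xs a _)) (*-congˡ (𝔼-*ˡ xs a F)) ⟩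
      (1# - p) * (a * 𝔼 p xs (F ∘ (x ∷_))) + p * (a * 𝔼 p xs F)
        ≈⟨ solve 5 (λ q p a y z → (q ⊗ (a ⊗ y) ⊕ p ⊗ (a ⊗ z)) ⊜ (a ⊗ (q ⊗ y ⊕ p ⊗ z))) ≈-refl (1# - p) p a _ _ ⟩
      a * 𝔼 p (x ∷ xs) F ∎

    𝔼-*ʳ : {X : Set} (E : List X) (F : List X → Carrier) (a : Carrier) → 𝔼 p E (λ A → F A * a) ≈ 𝔼 p E F * a
    𝔼-*ʳ E F a = ≈-trans (𝔼-cong E (λ A → *-comm (F A) a)) (≈-trans (𝔼-*ˡ E a F) (*-comm a _))

    𝔼-+ : {X : Set} (E : List X) (F F′ : List X → Carrier) → 𝔼 p E (λ A → F A + F′ A) ≈ 𝔼 p E F + 𝔼 p E F′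
    𝔼-+ []       F F′ = ≈-refl
    𝔼-+ (x ∷ xs) F F′ = ≈-trans
      (+-cong (*-congˡ (𝔼-+ xs _ _)) (*-congˡ (𝔼-+ xs F F′)))
      (solve 6 (λ q p y y′ z z′ → (q ⊗ (y ⊕ y′) ⊕ p ⊗ (z ⊕ z′)) ⊜ ((q ⊗ y ⊕ p ⊗ z) ⊕ (q ⊗ y′ ⊕ p ⊗ z′)))
               ≈-refl (1# - p) p _ _ _ _)

    𝔼-++ : {X : Set} (xs ys : List X) (F : List X → Carrier) →
           𝔼 p (xs ++ ys) F ≈ 𝔼 p xs (λ A → 𝔼 p ys (λ B → F (A ++ B)))
    𝔼-++ []       ys F = ≈-refl
    𝔼-++ (x ∷ xs) ys F = +-cong (*-congˡ (𝔼-++ xs ys _)) (*-congˡ (𝔼-++ xs ys F))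

    𝔼-map : {X Y : Set} (f : X → Y) (xs : List X) (F : List Y → Carrier) → 𝔼 p (map f xs) F ≈ 𝔼 p xs (F ∘ map f)
    𝔼-map f []       F = ≈-refl
    𝔼-map f (x ∷ xs) F = +-cong (*-congˡ (𝔼-map f xs _)) (*-congˡ (𝔼-map f xs F))

    -- F must ignore the order of its argument, since the entry at e is moved to the front
    𝔼-removeAt : {X : Set} (E : List X) (e : Fin (length E)) (F : List X → Carrier) →
                 (∀ {A A′} → A ↭ A′ → F A ≈ F A′) →
                 𝔼 p E F ≈ (1# - p) * 𝔼 p (removeAt E e) (F ∘ (lookup E e ∷_)) + p * 𝔼 p (removeAt E e) F
    𝔼-removeAt (x ∷ xs) Fin.zero    F F-resp = ≈-refl
    𝔼-removeAt (x ∷ xs) (Fin.suc e) F F-resp = begin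
      (1# - p) * 𝔼 p xs (F ∘ (x ∷_)) + p * 𝔼 p xs F
        ≈⟨ +-cong (*-congˡ (𝔼-removeAt xs e (F ∘ (x ∷_)) (F-resp ∘ ↭-prep x)))
                  (*-congˡ (𝔼-removeAt xs e F F-resp)) ⟩
      (1# - p) * ((1# - p) * 𝔼 p R (F ∘ (x ∷_) ∘ (y ∷_)) + p * 𝔼 p R (F ∘ (x ∷_)))
        + p * ((1# - p) * 𝔼 p R (F ∘ (y ∷_)) + p * 𝔼 p R F)
        ≈⟨ +-congʳ (*-congˡ (+-congʳ (*-congˡ (𝔼-cong R (λ A → F-resp (↭-swap x y ↭-refl)))))) ⟩
      (1# - p) * ((1# - p) * 𝔼 p R (F ∘ (y ∷_) ∘ (x ∷_)) + p * 𝔼 p R (F ∘ (x ∷_)))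
        + p * ((1# - p) * 𝔼 p R (F ∘ (y ∷_)) + p * 𝔼 p R F)
        ≈⟨ solve 6 (λ q p w x y z → (q ⊗ (q ⊗ w ⊕ p ⊗ x) ⊕ p ⊗ (q ⊗ y ⊕ p ⊗ z))
                                   ⊜ (q ⊗ (q ⊗ w ⊕ p ⊗ y) ⊕ p ⊗ (q ⊗ x ⊕ p ⊗ z))) ≈-refl (1# - p) p _ _ _ _ ⟩
      (1# - p) * 𝔼 p (x ∷ R) (F ∘ (y ∷_)) + p * 𝔼 p (x ∷ R) F ∎
      where
      y = lookup xs e
      R = removeAt xs e

    private
      ∑ : {X : Set} → (X → Carrier) → List X → Carrier
      ∑ f L = foldr _+_ 0# (map f L)

      ∑-++ : {X : Set} (f : X → Carrier) (xs ys : List X) → ∑ f (xs ++ ys) ≈ ∑ f xs + ∑ f ys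
      ∑-++ f []       ys = ≈-sym (+-identityˡ _)
      ∑-++ f (x ∷ xs) ys = ≈-trans (+-congˡ (∑-++ f xs ys)) (≈-sym (+-assoc _ _ _))

      ∑-cong : {X : Set} {f g : X → Carrier} (L : List X) → (∀ z → f z ≈ g z) → ∑ f L ≈ ∑ g L
      ∑-cong []      f≈g = ≈-refl
      ∑-cong (x ∷ L) f≈g = +-cong (f≈g x) (∑-cong L f≈g)

      ∑-*ˡ : {X : Set} (a : Carrier) (f : X → Carrier) (L : List X) → ∑ (λ z → a * f z) L ≈ a * ∑ f L
      ∑-*ˡ a f []      = ≈-sym (zeroʳ a)
      ∑-*ˡ a f (x ∷ L) = ≈-trans (+-congˡ (∑-*ˡ a f L)) (≈-sym (distribˡ a _ _))

      -- the summand of weightedSum with the exponent of p raised by d; the subsets of x ∷ xs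
      -- missing x are then the subsets of xs with d + 1, avoiding truncated subtraction
      term : {n : ℕ} → (List (Edge n) → Bool) → ℕ → List (Edge n) → List (Edge n) → Carrier
      term P d E A = if P A then ((1# - p) ^ length A) * (p ^ ((d ℕ.+ length E) ∸ length A)) else 0#

      ∑-term : {n : ℕ} (P : List (Edge n) → Bool) (d : ℕ) (E : List (Edge n)) →
               ∑ (term P d E) (subsets E) ≈ (p ^ d) * 𝔼 p E (𝟙 ∘ P)
      ∑-term P d [] with P []
      ... | true rewrite ℕₚ.+-identityʳ d = ≈-trans (+-identityʳ _) (≈-trans (*-identityˡ _) (≈-sym (*-identityʳ _)))
      ... | false = ≈-trans (+-identityʳ _) (≈-sym (zeroʳ _))
      ∑-term P d (x ∷ xs) = begin
        ∑ (term P d (x ∷ xs)) (map (x ∷_) (subsets xs) ++ subsets xs)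
          ≈⟨ ∑-++ _ (map (x ∷_) (subsets xs)) (subsets xs) ⟩
        ∑ (term P d (x ∷ xs)) (map (x ∷_) (subsets xs)) + ∑ (term P d (x ∷ xs)) (subsets xs)
          ≈⟨ +-congʳ (reflexive (cong (foldr _+_ 0#) (sym (map-∘ (subsets xs))))) ⟩
        ∑ (term P d (x ∷ xs) ∘ (x ∷_)) (subsets xs) + ∑ (term P d (x ∷ xs)) (subsets xs)
          ≈⟨ +-cong (∑-cong (subsets xs) kept) (∑-cong (subsets xs) dropped) ⟩
        ∑ (λ A → (1# - p) * term (P ∘ (x ∷_)) d xs A) (subsets xs) + ∑ (term P (suc d) xs) (subsets xs)
          ≈⟨ +-congʳ (∑-*ˡ _ _ (subsets xs)) ⟩
        (1# - p) * ∑ (term (P ∘ (x ∷_)) d xs) (subsets xs) + ∑ (term P (suc d) xs) (subsets xs)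
          ≈⟨ +-cong (*-congˡ (∑-term (P ∘ (x ∷_)) d xs)) (∑-term P (suc d) xs) ⟩
        (1# - p) * ((p ^ d) * 𝔼 p xs (𝟙 ∘ P ∘ (x ∷_))) + (p * (p ^ d)) * 𝔼 p xs (𝟙 ∘ P)
          ≈⟨ +-cong (x∙yz≈y∙xz _ _ _) (xy∙z≈y∙xz _ _ _) ⟩
        (p ^ d) * ((1# - p) * 𝔼 p xs (𝟙 ∘ P ∘ (x ∷_))) + (p ^ d) * (p * 𝔼 p xs (𝟙 ∘ P))
          ≈⟨ distribˡ (p ^ d) _ _ ⟨
        (p ^ d) * 𝔼 p (x ∷ xs) (𝟙 ∘ P) ∎
        where
        kept : ∀ A → term P d (x ∷ xs) (x ∷ A) ≈ (1# - p) * term (P ∘ (x ∷_)) d xs A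
        kept A with P (x ∷ A)
        ... | true rewrite ℕₚ.+-suc d (length xs) = *-assoc _ _ _
        ... | false = ≈-sym (zeroʳ _)
        dropped : ∀ A → term P d (x ∷ xs) A ≈ term P (suc d) xs A
        dropped A rewrite ℕₚ.+-suc d (length xs) = ≈-refl

    weightedSum≈𝔼 : {n : ℕ} (P : List (Edge n) → Bool) (E : List (Edge n)) → weightedSum P p E ≈ 𝔼 p E (𝟙 ∘ P)
    weightedSum≈𝔼 P E = ≈-trans (∑-term P 0 E) (*-identityˡ _)

-- Reliability of the substituted graph

module Reliability {c ℓ : Level} (ℛ : CommutativeRing c ℓ) where

  open CommutativeRing ℛ renaming (refl to ≈-refl; sym to ≈-sym; trans to ≈-trans)
  open Poly ℛ
  open Expectation ℛ
  open SetoidReasoning setoid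
  open RingProperties ring using (-‿distribˡ-*)
  open AbelianGroupProperties +-abelianGroup using (⁻¹-∙-comm)
  open CommutativeSemigroupProperties +-commutativeSemigroup using (interchange)
  open CommutativeSemigroupProperties *-commutativeSemigroup using (xy∙z≈xz∙y)

  +1-cancel : (x y : Carrier) → (x + 1#) - (y + 1#) ≈ x - y
  +1-cancel x y = begin
    (x + 1#) - (y + 1#)        ≈⟨ +-congˡ (⁻¹-∙-comm y 1#) ⟨
    (x + 1#) + (- y + - 1#)    ≈⟨ interchange x 1# (- y) (- 1#) ⟩
    (x - y) + (1# - 1#)        ≈⟨ +-congˡ (-‿inverseʳ 1#) ⟩
    (x - y) + 0#               ≈⟨ +-identityʳ _ ⟩
    x - y                      ∎

  +-*-sub-cancel : (a y x z : Carrier) → (a + y * z) + (x - y) * z ≈ a + x * z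
  +-*-sub-cancel a y x z = begin
    (a + y * z) + (x - y) * z         ≈⟨ +-congˡ (≈-trans (distribʳ z x (- y)) (+-congˡ (≈-sym (-‿distribˡ-* y z)))) ⟩
    (a + y * z) + (x * z - y * z)     ≈⟨ interchange a (y * z) (x * z) (- (y * z)) ⟩
    (a + x * z) + (y * z - y * z)     ≈⟨ +-congˡ (-‿inverseʳ (y * z)) ⟩
    (a + x * z) + 0#                  ≈⟨ +-identityʳ _ ⟩
    a + x * z                         ∎

  substitution-identity : (p r RG SG D R′ : Carrier) → r * RG ≈ 1# →
    ((1# - p) * r) * (RG * D + SG * R′) ≈ ((1# - p) * D + p * R′) + ((((1# - p) * SG) * r + 1#) - (p + 1#)) * R′
  substitution-identity p r RG SG D R′ r*RG≈1 = begin
    ((1# - p) * r) * (RG * D + SG * R′)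
      ≈⟨ distribˡ _ (RG * D) (SG * R′) ⟩
    ((1# - p) * r) * (RG * D) + ((1# - p) * r) * (SG * R′)
      ≈⟨ +-cong (*-assoc (1# - p) r (RG * D)) (≈-sym (*-assoc ((1# - p) * r) SG R′)) ⟩
    (1# - p) * (r * (RG * D)) + (((1# - p) * r) * SG) * R′
      ≈⟨ +-cong (*-congˡ (≈-sym (*-assoc r RG D))) (*-congʳ (xy∙z≈xz∙y (1# - p) r SG)) ⟩
    (1# - p) * ((r * RG) * D) + X * R′
      ≈⟨ +-congʳ (*-congˡ (≈-trans (*-congʳ r*RG≈1) (*-identityˡ D))) ⟩
    (1# - p) * D + X * R′
      ≈⟨ +-*-sub-cancel ((1# - p) * D) p X R′ ⟨
    ((1# - p) * D + p * R′) + (X - p) * R′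
      ≈⟨ +-congˡ (*-congʳ (+1-cancel X p)) ⟨
    ((1# - p) * D + p * R′) + ((X + 1#) - (p + 1#)) * R′ ∎
    where
    X = ((1# - p) * SG) * r

  RelForced : (H : Graph) → Fin (length (edges H)) → Carrier → Carrier
  RelForced H e p = 𝔼 p (removeAt (edges H) e) (𝟙 ∘ connected ∘ (lookup (edges H) e ∷_))

  Rel-condition : (H : Graph) (e : Fin (length (edges H))) (p : Carrier) →
                  Rel H p ≈ (1# - p) * RelForced H e p + p * Rel (deleteEdge H e) p
  Rel-condition H e p = begin
    Rel H p                                    ≈⟨ weightedSum≈𝔼 p connected (edges H) ⟩
    𝔼 p (edges H) (𝟙 ∘ connected)             ≈⟨ 𝔼-removeAt p (edges H) e _ (reflexive ∘ cong 𝟙 ∘ connected-resp-↭) ⟩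
    (1# - p) * RelForced H e p + p * _         ≈⟨ +-congˡ (*-congˡ (≈-sym (weightedSum≈𝔼 p connected (removeAt (edges H) e)))) ⟩
    (1# - p) * RelForced H e p + p * Rel (deleteEdge H e) p ∎

  module _ {n′ : ℕ} (E : List (Edge (suc n′))) (e : Fin (length E)) (G : TwoTerminal) (flip : Bool) where

    private
      H = graph (suc n′) E
      ab = lookup E e
      u = if flip then proj₂ ab else proj₁ ab
      v = if flip then proj₁ ab else proj₂ ab
      R = removeAt E e

    open Glue E G u v

    𝟙-connected-glued : ∀ a b → 𝟙 (connected (glued a b))
                          ≈ 𝟙 (connected b) * 𝟙 (connected (ab ∷ a)) + 𝟙 (isSplit b (s G) (t G)) * 𝟙 (connected a)
    𝟙-connected-glued a b with connected b in conn-b | isSplit b (s G) (t G) in split-b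
    ... | true  | true  = ⊥-elim (connected⇒¬isSplit {A = b} (from T-≡ conn-b) (from T-≡ split-b))
    ... | true  | false = begin
      𝟙 (connected (glued a b))            ≡⟨ cong 𝟙 (trans (glued-connected-if-connected a b (from T-≡ conn-b))
                                                                (connected-orient flip ab a)) ⟩
      𝟙 (connected (ab ∷ a))               ≈⟨ ≈-trans (+-cong (*-identityˡ _) (zeroˡ _)) (+-identityʳ _) ⟨
      1# * 𝟙 (connected (ab ∷ a)) + 0# * 𝟙 (connected a) ∎
    ... | false | true  = begin
      𝟙 (connected (glued a b))            ≡⟨ cong 𝟙 (glued-connected-if-split a b (from T-≡ split-b)) ⟩
      𝟙 (connected a)                      ≈⟨ ≈-trans (+-cong (zeroˡ _) (*-identityˡ _)) (+-identityˡ _) ⟨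
      0# * 𝟙 (connected (ab ∷ a)) + 1# * 𝟙 (connected a) ∎
    ... | false | false = begin
      𝟙 (connected (glued a b))
        ≡⟨ cong 𝟙 (T-injective (mk⇔ (glued-disconnected a b (subst T conn-b) (subst T split-b)) λ ())) ⟩
      0#                                   ≈⟨ ≈-trans (+-cong (zeroˡ _) (zeroˡ _)) (+-identityʳ _) ⟨
      0# * 𝟙 (connected (ab ∷ a)) + 0# * 𝟙 (connected a) ∎

    Rel-substitute : (p : Carrier) →
      Rel (substitute H e G flip) p ≈ Rel (underlying G) p * RelForced H e p + Spl G p * Rel (deleteEdge H e) p
    Rel-substitute p = begin
      Rel (substitute H e G flip) p
        ≈⟨ weightedSum≈𝔼 p connected (map edgeH R ++ map edgeG EG) ⟩
      𝔼 p (map edgeH R ++ map edgeG EG) (𝟙 ∘ connected)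
        ≈⟨ 𝔼-++ p (map edgeH R) _ _ ⟩
      𝔼 p (map edgeH R) (λ A → 𝔼 p (map edgeG EG) (λ B → 𝟙 (connected (A ++ B))))
        ≈⟨ 𝔼-map p edgeH R _ ⟩
      𝔼 p R (λ a → 𝔼 p (map edgeG EG) (λ B → 𝟙 (connected (map edgeH a ++ B))))
        ≈⟨ 𝔼-cong p R (λ a → 𝔼-map p edgeG EG _) ⟩
      𝔼 p R (λ a → 𝔼 p EG (𝟙 ∘ connected ∘ glued a))
        ≈⟨ 𝔼-cong p R (λ a → 𝔼-cong p EG (𝟙-connected-glued a)) ⟩
      𝔼 p R (λ a → 𝔼 p EG (λ b → 𝟙 (connected b) * 𝟙 (connected (ab ∷ a)) + 𝟙 (split b) * 𝟙 (connected a)))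
        ≈⟨ 𝔼-cong p R (λ a → ≈-trans (𝔼-+ p EG _ _) (+-cong (𝔼-*ʳ p EG _ _) (𝔼-*ʳ p EG _ _))) ⟩
      𝔼 p R (λ a → 𝔼 p EG (𝟙 ∘ connected) * 𝟙 (connected (ab ∷ a)) + 𝔼 p EG (𝟙 ∘ split) * 𝟙 (connected a))
        ≈⟨ 𝔼-cong p R (λ a → +-cong (*-congʳ (≈-sym (weightedSum≈𝔼 p connected EG)))
                                     (*-congʳ (≈-sym (weightedSum≈𝔼 p split EG)))) ⟩
      𝔼 p R (λ a → RG * 𝟙 (connected (ab ∷ a)) + SG * 𝟙 (connected a))
        ≈⟨ ≈-trans (𝔼-+ p R _ _) (+-cong (𝔼-*ˡ p R RG _) (𝔼-*ˡ p R SG _)) ⟩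
      RG * RelForced H e p + SG * 𝔼 p R (𝟙 ∘ connected)
        ≈⟨ +-congˡ (*-congˡ (≈-sym (weightedSum≈𝔼 p connected R))) ⟩
      RG * RelForced H e p + SG * Rel (deleteEdge H e) p ∎
      where
      edgeH = glueH H G u v
      edgeG = glueE H G u v
      EG = tedges G
      split = λ b → isSplit b (s G) (t G)
      RG = Rel (underlying G) p
      SG = Spl G p

lemma2p6 : {c ℓ : Level} (ℛ : CommutativeRing c ℓ) →
  let open CommutativeRing ℛ
      open Poly ℛ
  in (H : Graph) (e : Fin (length (edges H))) (G : TwoTerminal) (flip : Bool) (p r : Carrier) →
     r * Rel (underlying G) p ≈ 1# →
     ((1# - p) * r) * Rel (substitute H e G flip) p
       ≈ Rel H p + ((((1# - p) * Spl G p) * r + 1#) - (p + 1#)) * Rel (deleteEdge H e) p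
lemma2p6 ℛ (graph zero []) ()
lemma2p6 ℛ (graph zero ((() , _) ∷ _)) e G flip p r r-inverse
lemma2p6 ℛ H@(graph (suc n′) E) e G flip p r r-inverse = begin
  ((1# - p) * r) * Rel (substitute H e G flip) p
    ≈⟨ *-congˡ (Rel-substitute E e G flip p) ⟩
  ((1# - p) * r) * (Rel (underlying G) p * RelForced H e p + Spl G p * Rel (deleteEdge H e) p)
    ≈⟨ substitution-identity p r _ _ _ _ r-inverse ⟩
  ((1# - p) * RelForced H e p + p * Rel (deleteEdge H e) p) + (y - (p + 1#)) * Rel (deleteEdge H e) p
    ≈⟨ +-congʳ (Rel-condition H e p) ⟨
  Rel H p + (y - (p + 1#)) * Rel (deleteEdge H e) p ∎
  where
  open CommutativeRing ℛ
  open Poly ℛ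
  open Reliability ℛ
  open SetoidReasoning setoid
  y = ((1# - p) * Spl G p) * r + 1#
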